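{- Let $p>5$ be a prime, and let $\{u_n\}_{n\geq0}$ be defined by $u_0=0$, $u_1=1$, $u_{n+1}=2u_n-5u_{n-1}$ for $n\geq1$. If $p\equiv1\pmod4$, then $$\frac{u_{p-1}}{p}\equiv\frac1{10}\sum_{k=1}^{\frac{p-1}{4}}\frac{16^k}{k}+\frac1{40}\sum_{k=1}^{\frac{p-1}{4}}\frac{16^k}{4k-3}+\frac25q_p(2)+\frac3{20}q_p(3)\pmod p;$$ if $p\equiv3\pmod4$, then $$\frac{u_{p+1}}{p}\equiv\frac18\sum_{k=1}^{\frac{p+1}{4}}\frac{16^k}{4k-3}-\frac12\sum_{k=1}^{\frac{p-3}{4}}\frac{16^k}{k}-\frac94q_p(3)\pmod p.$$
   Context: $q_p(x)=\frac{x^{p-1}-1}{p}$ for $p\nmid x$. Congruences between rationals with denominators prime to $p$ are understood in the ring of $p$-integral rationals. -}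

module Defs where

open import Data.Nat as ℕ using (ℕ; zero; suc; _∸_; _^_)
open import Data.Nat.Divisibility as ℕD using ()
open import Data.Integer as ℤ using (ℤ; +_)
open import Data.Integer.Divisibility as ℤD using ()
open import Data.Rational as ℚ using (ℚ; ↥_; ↧ₙ_; _/_; _+_; _-_; _*_)
open import Data.Product using (_×_)
open import Relation.Nullary using (¬_)

u : ℕ → ℤ
u zero = + 0
u (suc zero) = + 1
u (suc (suc n)) = (+ 2) ℤ.* u (suc n) ℤ.- (+ 5) ℤ.* u n

-- division by a positive natural d; we use suc (d ∸ 1), which equals d
-- whenever d ≥ 1 (all uses below have d ≥ 1)
_÷ℕ_ : ℤ → ℕ → ℚ
n ÷ℕ d = n / suc (d ∸ 1)

qp : ℕ → ℕ → ℚ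
qp p x = ((+ (x ^ (p ∸ 1))) ℤ.- (+ 1)) ÷ℕ p

fr : ℤ → ℕ → ℚ
fr a b = a ÷ℕ b

Σ1 : ℕ → (ℕ → ℚ) → ℚ
Σ1 zero f = ℚ.0ℚ
Σ1 (suc m) f = Σ1 m f + f (suc m)

-- congruence of rationals modulo p in the ring of p-integral rationals:
-- a ≡ b (mod p) iff a - b = n/d (reduced) with p ∤ d and p ∣ n.
-- (Both sides p-integral is implied by / part of this requirement on the difference.)
_≡ℚ_[mod_] : ℚ → ℚ → ℕ → Set
a ≡ℚ b [mod p ] = (ℤ.+ p ℤD.∣ ↥ (a - b)) × ¬ (p ℕD.∣ ↧ₙ (a - b))

-- Let F r n = Σ_{j ≡ r (mod 4)} C(n,j) 2^j. Evaluating Σ_j C(n,j) x^j = (1+x)^n at x = ±2, ±2i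
-- gives F₀ + F₁ + F₂ + F₃ = 3^n, F₀ - F₁ + F₂ - F₃ = (-1)^n and (F₀ - F₂) + (F₁ - F₃) i = (1+2i)^n,
-- and the last one is expressed through u because 1 ± 2i are the roots of x² - 2x + 5. At n = p
-- this writes 40 u_{p-1} (p ≡ 1 mod 4), resp. 8 u_{p+1} (p ≡ 3 mod 4), as an integer combination
-- of 2^{p-1} - 1, 3^{p-1} - 1 and the sums Σ_k C(p,4k) 16^k and Σ_k C(p,4k-3) 16^k. After division
-- by p, the congruence C(p,j)/p = C(p-1,j-1)/j ≡ (-1)^{j-1}/j (mod p) turns these sums into
-- Σ 16^k/k and Σ 16^k/(4k-3).

module Submission where

open import Data.Nat using (ℕ; suc)
open import Data.Nat.Primality using (Prime)

module IntegerSums where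

  open import Data.Nat as ℕ using (ℕ; zero; suc)
  open import Data.Integer using (ℤ; +_; _+_; _*_)
  import Data.Integer.Properties as ℤP
  open import Data.Integer.Tactic.RingSolver using (solve-∀)
  open import Relation.Binary.PropositionalEquality

  Σ< : ℕ → (ℕ → ℤ) → ℤ
  Σ< zero    g = + 0
  Σ< (suc n) g = Σ< n g + g n

  Σ<-cong : ∀ n {f g : ℕ → ℤ} → (∀ j → f j ≡ g j) → Σ< n f ≡ Σ< n g
  Σ<-cong zero    f≡g = refl
  Σ<-cong (suc n) f≡g = cong₂ _+_ (Σ<-cong n f≡g) (f≡g n)

  Σ<-distrib-+ : ∀ n (f g : ℕ → ℤ) → Σ< n (λ j → f j + g j) ≡ Σ< n f + Σ< n g
  Σ<-distrib-+ zero    f g = refl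
  Σ<-distrib-+ (suc n) f g =
    trans (cong (_+ (f n + g n)) (Σ<-distrib-+ n f g)) (swap (Σ< n f) (Σ< n g) (f n) (g n))
    where
    swap : ∀ a b c d → (a + b) + (c + d) ≡ (a + c) + (b + d)
    swap = solve-∀

  Σ<-*ˡ : ∀ n c (f : ℕ → ℤ) → Σ< n (λ j → c * f j) ≡ c * Σ< n f
  Σ<-*ˡ zero    c f = sym (ℤP.*-zeroʳ c)
  Σ<-*ˡ (suc n) c f =
    trans (cong (_+ c * f n) (Σ<-*ˡ n c f)) (sym (ℤP.*-distribˡ-+ c (Σ< n f) (f n)))

  Σ<-shift : ∀ n (g : ℕ → ℤ) → Σ< (suc n) g ≡ g 0 + Σ< n (λ j → g (suc j))
  Σ<-shift zero    g = trans (ℤP.+-identityˡ (g 0)) (sym (ℤP.+-identityʳ (g 0)))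
  Σ<-shift (suc n) g = trans (cong (_+ g (suc n)) (Σ<-shift n g)) (ℤP.+-assoc (g 0) _ _)

  Σ<-blocks : ∀ M (g : ℕ → ℤ) →
    Σ< (M ℕ.* 4) g
      ≡ Σ< M (λ k → g (k ℕ.* 4) + g (1 ℕ.+ k ℕ.* 4) + g (2 ℕ.+ k ℕ.* 4) + g (3 ℕ.+ k ℕ.* 4))
  Σ<-blocks zero    g = refl
  Σ<-blocks (suc M) g =
    trans (assoc (Σ< (M ℕ.* 4) g) _ _ _ _) (cong (_+ block M) (Σ<-blocks M g))
    where
    block : ℕ → ℤ
    block k = g (k ℕ.* 4) + g (1 ℕ.+ k ℕ.* 4) + g (2 ℕ.+ k ℕ.* 4) + g (3 ℕ.+ k ℕ.* 4)
    assoc : ∀ s a b c d → s + a + b + c + d ≡ s + (a + b + c + d)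
    assoc = solve-∀

module Binomial where

  open import Data.Nat as ℕ using (ℕ; zero; suc; _<_; _≤_; s≤s)
  import Data.Nat.Properties as ℕP
  import Data.Nat.Divisibility as ℕD
  open import Data.Nat.Primality using (Prime; euclidsLemma)
  open import Data.Integer using (ℤ; +_; _+_; _*_; _-_; -1ℤ; _^_; ∣_∣)
  import Data.Integer.Properties as ℤP
  open import Data.Integer.Divisibility.Signed
    using (_∣_; ∣⇒∣ᵤ; ∣ᵤ⇒∣; ∣-refl; ∣m⇒∣m*n; ∣m∣n⇒∣m-n; divides)
  open import Data.Integer.Tactic.RingSolver using (solve-∀)
  open import Data.Sum using ([_,_]′; inj₁; inj₂)
  open import Data.Empty using (⊥-elim)
  open import Relation.Binary.PropositionalEquality
  open ≡-Reasoning
  open IntegerSums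

  binomial : ℕ → ℕ → ℤ
  binomial n       zero    = + 1
  binomial zero    (suc k) = + 0
  binomial (suc n) (suc k) = binomial n k + binomial n (suc k)

  binomial-vanishes : ∀ {n k} → n < k → binomial n k ≡ + 0
  binomial-vanishes {zero}  {suc k} _         = refl
  binomial-vanishes {suc n} {suc k} (s≤s n<k) =
    cong₂ _+_ (binomial-vanishes n<k) (binomial-vanishes (ℕP.m<n⇒m<1+n n<k))

  binomial-diagonal : ∀ n → binomial n n ≡ + 1
  binomial-diagonal zero    = refl
  binomial-diagonal (suc n) =
    cong₂ _+_ (binomial-diagonal n) (binomial-vanishes (ℕP.n<1+n n))

  binomial-absorption : ∀ n k → + suc k * binomial (suc n) (suc k) ≡ + suc n * binomial n k
  binomial-absorption zero    zero    = refl
  binomial-absorption zero    (suc k) = ℤP.*-zeroʳ (+ suc (suc k))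
  binomial-absorption (suc n) zero    = begin
      + 1 * (+ 1 + binomial (suc n) 1)   ≡⟨ ℤP.*-identityˡ _ ⟩
      + 1 + binomial (suc n) 1           ≡⟨ cong (_+_ (+ 1)) (ℤP.*-identityˡ (binomial (suc n) 1)) ⟨
      + 1 + + 1 * binomial (suc n) 1     ≡⟨ cong (_+_ (+ 1)) (binomial-absorption n zero) ⟩
      + 1 + + suc n * + 1                ≡⟨ ℤP.*-distribʳ-+ (+ 1) (+ 1) (+ suc n) ⟨
      + suc (suc n) * + 1                ∎
  binomial-absorption (suc n) (suc k) = begin
      + suc (suc k) * (binomial (suc n) (suc k) + binomial (suc n) (suc (suc k)))
    ≡⟨ split (+ suc k) (binomial (suc n) (suc k)) (binomial (suc n) (suc (suc k))) ⟩
      + suc k * binomial (suc n) (suc k) + binomial (suc n) (suc k)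
        + + suc (suc k) * binomial (suc n) (suc (suc k))
    ≡⟨ cong₂ (λ x y → x + binomial (suc n) (suc k) + y)
         (binomial-absorption n k) (binomial-absorption n (suc k)) ⟩
      + suc n * binomial n k + binomial (suc n) (suc k) + + suc n * binomial n (suc k)
    ≡⟨ merge (+ suc n) (binomial n k) (binomial n (suc k)) ⟩
      + suc (suc n) * binomial (suc n) (suc k) ∎
    where
    split : ∀ K a b → (+ 1 + K) * (a + b) ≡ K * a + a + (+ 1 + K) * b
    split = solve-∀
    merge : ∀ N a b → N * a + (a + b) + N * b ≡ (+ 1 + N) * (a + b)
    merge = solve-∀

  prime∣binomial : ∀ {n} → Prime (suc n) → ∀ {k} → k < n → + suc n ∣ binomial (suc n) (suc k)
  prime∣binomial {n} p-prime {k} k<n =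
    [ (λ p∣k+1 → ⊥-elim (ℕD.>⇒∤ (s≤s k<n) p∣k+1)) , ∣ᵤ⇒∣ ]′
      (euclidsLemma (suc k) ∣ binomial (suc n) (suc k) ∣ p-prime p∣product)
    where
    p∣product : suc n ℕD.∣ suc k ℕ.* ∣ binomial (suc n) (suc k) ∣
    p∣product = subst (suc n ℕD.∣_) (ℤP.abs-* (+ suc k) (binomial (suc n) (suc k)))
      (∣⇒∣ᵤ (subst (+ suc n ∣_) (sym (binomial-absorption n k)) (∣m⇒∣m*n (binomial n k) ∣-refl)))

  -1ℤ^[k*4]≡1 : ∀ k → -1ℤ ^ (k ℕ.* 4) ≡ + 1
  -1ℤ^[k*4]≡1 zero    = refl
  -1ℤ^[k*4]≡1 (suc k) = cong (λ s → -1ℤ * (-1ℤ * (-1ℤ * (-1ℤ * s)))) (-1ℤ^[k*4]≡1 k)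

  binomial[p-1]≡sign : ∀ {n} → Prime (suc n) → ∀ {j} → j ≤ n → + suc n ∣ binomial n j - -1ℤ ^ j
  binomial[p-1]≡sign p-prime {zero}  _   = divides (+ 0) refl
  binomial[p-1]≡sign {n} p-prime {suc j} j<n =
    subst (+ suc n ∣_) (pascal (binomial n j) (binomial n (suc j)) (-1ℤ ^ j))
      (∣m∣n⇒∣m-n (prime∣binomial p-prime j<n) (binomial[p-1]≡sign p-prime (ℕP.<⇒≤ j<n)))
    where
    pascal : ∀ a b s → (a + b) - (a - s) ≡ b - -1ℤ * s
    pascal = solve-∀

  binomialSum : ℕ → (ℕ → ℤ) → ℤ
  binomialSum n f = Σ< (suc n) (λ j → binomial n j * f j)

  binomialSum-extend : ∀ {n N} (f : ℕ → ℤ) → n < N → Σ< N (λ j → binomial n j * f j) ≡ binomialSum n f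
  binomialSum-extend {n} {suc N} f n<1+N with ℕP.m<1+n⇒m<n∨m≡n n<1+N
  ... | inj₂ refl = refl
  ... | inj₁ n<N  = begin
      Σ< N (λ j → binomial n j * f j) + binomial n N * f N
    ≡⟨ cong₂ _+_ (binomialSum-extend f n<N) (cong (_* f N) (binomial-vanishes n<N)) ⟩
      binomialSum n f + + 0 * f N
    ≡⟨ ℤP.+-identityʳ _ ⟩
      binomialSum n f ∎

  binomialSum-suc : ∀ n f → binomialSum (suc n) f ≡ binomialSum n f + binomialSum n (λ j → f (suc j))
  binomialSum-suc n f = begin
      binomialSum (suc n) f
    ≡⟨ Σ<-shift (suc n) _ ⟩
      + 1 * f 0 + Σ< (suc n) (λ j → (binomial n j + binomial n (suc j)) * f (suc j))
    ≡⟨ cong (_+_ (+ 1 * f 0)) (trans (Σ<-cong (suc n) λ j → ℤP.*-distribʳ-+ (f (suc j)) (binomial n j) _)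
                                     (Σ<-distrib-+ (suc n) _ _)) ⟩
      + 1 * f 0 + (binomialSum n (λ j → f (suc j)) + Σ< (suc n) (λ j → binomial n (suc j) * f (suc j)))
    ≡⟨ rotate (+ 1 * f 0) (binomialSum n (λ j → f (suc j))) _ ⟩
      (+ 1 * f 0 + Σ< (suc n) (λ j → binomial n (suc j) * f (suc j))) + binomialSum n (λ j → f (suc j))
    ≡⟨ cong (_+ binomialSum n (λ j → f (suc j)))
         (trans (sym (Σ<-shift (suc n) (λ j → binomial n j * f j)))
                (binomialSum-extend f (ℕP.m<n⇒m<1+n (ℕP.n<1+n n)))) ⟩
      binomialSum n f + binomialSum n (λ j → f (suc j)) ∎
    where
    rotate : ∀ a b c → a + (b + c) ≡ (a + c) + b
    rotate = solve-∀

  binomialSum-*ˡ : ∀ n c f → binomialSum n (λ j → c * f j) ≡ c * binomialSum n f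
  binomialSum-*ˡ n c f =
    trans (Σ<-cong (suc n) λ j → commute (binomial n j) c (f j)) (Σ<-*ˡ (suc n) c _)
    where
    commute : ∀ b c x → b * (c * x) ≡ c * (b * x)
    commute = solve-∀

  blockSum : ℕ → (ℕ → ℤ) → ℕ → ℤ
  blockSum n f k = term (k ℕ.* 4) + term (1 ℕ.+ k ℕ.* 4) + term (2 ℕ.+ k ℕ.* 4) + term (3 ℕ.+ k ℕ.* 4)
    where
    term : ℕ → ℤ
    term j = binomial n j * f j

  binomialSum-blocks : ∀ {n} M f → n < M ℕ.* 4 → binomialSum n f ≡ Σ< M (blockSum n f)
  binomialSum-blocks M f n<4M = trans (sym (binomialSum-extend f n<4M)) (Σ<-blocks M _)

module QuarterSums where

  open import Data.Nat as ℕ using (ℕ; zero; suc; _<_; _^_)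
  open import Data.Integer using (ℤ; +_; -_; _+_; _*_; _-_; -1ℤ)
  import Data.Integer as ℤ
  import Data.Integer.Properties as ℤP
  import Data.Nat.Properties as ℕP
  open import Data.Integer.Tactic.RingSolver using (solve-∀)
  open import Data.Product using (_×_; _,_; proj₁; proj₂)
  open import Relation.Binary.PropositionalEquality
  open ≡-Reasoning
  open import Defs using (u)
  open IntegerSums
  open Binomial

  -- eᵣ j is 2 ^ j when j ≡ r (mod 4), and 0 otherwise.
  mutual
    e₀ e₁ e₂ e₃ : ℕ → ℤ
    e₀ zero    = + 1
    e₀ (suc j) = + 2 * e₃ j
    e₁ zero    = + 0
    e₁ (suc j) = + 2 * e₀ j
    e₂ zero    = + 0
    e₂ (suc j) = + 2 * e₁ j
    e₃ zero    = + 0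
    e₃ (suc j) = + 2 * e₂ j

  F₀ F₁ F₂ F₃ : ℕ → ℤ
  F₀ n = binomialSum n e₀
  F₁ n = binomialSum n e₁
  F₂ n = binomialSum n e₂
  F₃ n = binomialSum n e₃

  F₀-suc : ∀ n → F₀ (suc n) ≡ F₀ n + + 2 * F₃ n
  F₀-suc n = trans (binomialSum-suc n e₀) (cong (_+_ (F₀ n)) (binomialSum-*ˡ n (+ 2) e₃))

  F₁-suc : ∀ n → F₁ (suc n) ≡ F₁ n + + 2 * F₀ n
  F₁-suc n = trans (binomialSum-suc n e₁) (cong (_+_ (F₁ n)) (binomialSum-*ˡ n (+ 2) e₀))

  F₂-suc : ∀ n → F₂ (suc n) ≡ F₂ n + + 2 * F₁ n
  F₂-suc n = trans (binomialSum-suc n e₂) (cong (_+_ (F₂ n)) (binomialSum-*ˡ n (+ 2) e₁))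

  F₃-suc : ∀ n → F₃ (suc n) ≡ F₃ n + + 2 * F₂ n
  F₃-suc n = trans (binomialSum-suc n e₃) (cong (_+_ (F₃ n)) (binomialSum-*ˡ n (+ 2) e₂))

  F-total : ∀ n → F₀ n + F₁ n + F₂ n + F₃ n ≡ + (3 ^ n)
  F-total zero = refl
  F-total (suc n) rewrite F₀-suc n | F₁-suc n | F₂-suc n | F₃-suc n = begin
      (F₀ n + + 2 * F₃ n) + (F₁ n + + 2 * F₀ n) + (F₂ n + + 2 * F₁ n) + (F₃ n + + 2 * F₂ n)
    ≡⟨ triple (F₀ n) (F₁ n) (F₂ n) (F₃ n) ⟩
      + 3 * (F₀ n + F₁ n + F₂ n + F₃ n)
    ≡⟨ cong (_*_ (+ 3)) (F-total n) ⟩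
      + 3 * + (3 ^ n)
    ≡⟨ ℤP.pos-* 3 (3 ^ n) ⟨
      + (3 ^ suc n) ∎
    where
    triple : ∀ a b c d → (a + + 2 * d) + (b + + 2 * a) + (c + + 2 * b) + (d + + 2 * c) ≡ + 3 * (a + b + c + d)
    triple = solve-∀

  F-alternating : ∀ n → F₀ n - F₁ n + F₂ n - F₃ n ≡ -1ℤ ℤ.^ n
  F-alternating zero = refl
  F-alternating (suc n) rewrite F₀-suc n | F₁-suc n | F₂-suc n | F₃-suc n = begin
      (F₀ n + + 2 * F₃ n) - (F₁ n + + 2 * F₀ n) + (F₂ n + + 2 * F₁ n) - (F₃ n + + 2 * F₂ n)
    ≡⟨ negate (F₀ n) (F₁ n) (F₂ n) (F₃ n) ⟩
      -1ℤ * (F₀ n - F₁ n + F₂ n - F₃ n)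
    ≡⟨ cong (-1ℤ *_) (F-alternating n) ⟩
      -1ℤ ℤ.^ suc n ∎
    where
    negate : ∀ a b c d → (a + + 2 * d) - (b + + 2 * a) + (c + + 2 * b) - (d + + 2 * c) ≡ -1ℤ * (a - b + c - d)
    negate = solve-∀

  F-lucas : ∀ n → (F₀ n - F₂ n ≡ u (suc n) - u n) × (F₁ n - F₃ n ≡ + 2 * u n)
  F-lucas zero = refl , refl
  F-lucas (suc n) rewrite F₀-suc n | F₁-suc n | F₂-suc n | F₃-suc n with F-lucas n
  ... | real , imaginary =
        trans (real-step (F₀ n) (F₁ n) (F₂ n) (F₃ n))
          (trans (cong₂ (λ x y → x - + 2 * y) real imaginary) (real-lucas (u (suc n)) (u n)))
      , trans (imaginary-step (F₀ n) (F₁ n) (F₂ n) (F₃ n))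
          (trans (cong₂ (λ x y → x + + 2 * y) imaginary real) (imaginary-lucas (u (suc n)) (u n)))
    where
    real-step : ∀ a b c d → (a + + 2 * d) - (c + + 2 * b) ≡ (a - c) - + 2 * (b - d)
    real-step = solve-∀
    imaginary-step : ∀ a b c d → (b + + 2 * a) - (d + + 2 * c) ≡ (b - d) + + 2 * (a - c)
    imaginary-step = solve-∀
    real-lucas : ∀ x y → (x - y) - + 2 * (+ 2 * y) ≡ (+ 2 * x - + 5 * y) - x
    real-lucas = solve-∀
    imaginary-lucas : ∀ x y → + 2 * y + + 2 * (x - y) ≡ + 2 * x
    imaginary-lucas = solve-∀

  four-F₀ : ∀ n → + 4 * F₀ n ≡ + (3 ^ n) + -1ℤ ℤ.^ n + + 2 * (u (suc n) - u n)
  four-F₀ n = begin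
      + 4 * F₀ n
    ≡⟨ combine (F₀ n) (F₁ n) (F₂ n) (F₃ n) ⟩
      (F₀ n + F₁ n + F₂ n + F₃ n) + (F₀ n - F₁ n + F₂ n - F₃ n) + + 2 * (F₀ n - F₂ n)
    ≡⟨ cong₂ _+_ (cong₂ _+_ (F-total n) (F-alternating n)) (cong (_*_ (+ 2)) (proj₁ (F-lucas n))) ⟩
      + (3 ^ n) + -1ℤ ℤ.^ n + + 2 * (u (suc n) - u n) ∎
    where
    combine : ∀ a b c d → + 4 * a ≡ (a + b + c + d) + (a - b + c - d) + + 2 * (a - c)
    combine = solve-∀

  four-F₁ : ∀ n → + 4 * F₁ n ≡ + (3 ^ n) - -1ℤ ℤ.^ n + + 2 * (+ 2 * u n)
  four-F₁ n = begin
      + 4 * F₁ n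
    ≡⟨ combine (F₀ n) (F₁ n) (F₂ n) (F₃ n) ⟩
      (F₀ n + F₁ n + F₂ n + F₃ n) - (F₀ n - F₁ n + F₂ n - F₃ n) + + 2 * (F₁ n - F₃ n)
    ≡⟨ cong₂ _+_ (cong₂ _-_ (F-total n) (F-alternating n)) (cong (_*_ (+ 2)) (proj₂ (F-lucas n))) ⟩
      + (3 ^ n) - -1ℤ ℤ.^ n + + 2 * (+ 2 * u n) ∎
    where
    combine : ∀ a b c d → + 4 * b ≡ (a + b + c + d) - (a - b + c - d) + + 2 * (b - d)
    combine = solve-∀

  module _ (n : ℕ) (odd : -1ℤ ℤ.^ suc n ≡ -1ℤ) where

    private
      T = + (3 ^ n)

      four-F₀-odd : + 4 * F₀ (suc n) ≡ + 3 * T - + 1 + + 2 * (u (suc (suc n)) - u (suc n))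
      four-F₀-odd = trans (four-F₀ (suc n))
        (cong₂ (λ t s → t + s + + 2 * (u (suc (suc n)) - u (suc n))) (ℤP.pos-* 3 (3 ^ n)) odd)

      four-F₁-odd : + 4 * F₁ (suc n) ≡ + 3 * T + + 1 + + 2 * (+ 2 * u (suc n))
      four-F₁-odd = trans (four-F₁ (suc n))
        (cong₂ (λ t s → t - s + + 2 * (+ 2 * u (suc n))) (ℤP.pos-* 3 (3 ^ n)) odd)

    u[n]-via-F[1+n] : + 40 * u n ≡ + 8 * F₁ (suc n) - + 16 * F₀ (suc n) + + 6 * T - + 6
    u[n]-via-F[1+n] = sym (begin
        + 8 * F₁ (suc n) - + 16 * F₀ (suc n) + + 6 * T - + 6
      ≡⟨ regroup (F₀ (suc n)) (F₁ (suc n)) T ⟩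
        + 2 * (+ 4 * F₁ (suc n)) - + 4 * (+ 4 * F₀ (suc n)) + + 6 * T - + 6
      ≡⟨ cong₂ (λ x y → + 2 * x - + 4 * y + + 6 * T - + 6) four-F₁-odd four-F₀-odd ⟩
        + 2 * (+ 3 * T + + 1 + + 2 * (+ 2 * u (suc n)))
          - + 4 * (+ 3 * T - + 1 + + 2 * ((+ 2 * u (suc n) - + 5 * u n) - u (suc n))) + + 6 * T - + 6
      ≡⟨ cancel (u (suc n)) (u n) T ⟩
        + 40 * u n ∎)
      where
      regroup : ∀ a b T → + 8 * b - + 16 * a + + 6 * T - + 6 ≡ + 2 * (+ 4 * b) - + 4 * (+ 4 * a) + + 6 * T - + 6
      regroup = solve-∀
      cancel : ∀ x y T → + 2 * (+ 3 * T + + 1 + + 2 * (+ 2 * x))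
                           - + 4 * (+ 3 * T - + 1 + + 2 * ((+ 2 * x - + 5 * y) - x)) + + 6 * T - + 6
                         ≡ + 40 * y
      cancel = solve-∀

    u[2+n]-via-F[1+n] : + 8 * u (suc (suc n)) ≡ + 8 * F₁ (suc n) + + 16 * F₀ (suc n) - + 18 * T + + 2
    u[2+n]-via-F[1+n] = sym (begin
        + 8 * F₁ (suc n) + + 16 * F₀ (suc n) - + 18 * T + + 2
      ≡⟨ regroup (F₀ (suc n)) (F₁ (suc n)) T ⟩
        + 2 * (+ 4 * F₁ (suc n)) + + 4 * (+ 4 * F₀ (suc n)) - + 18 * T + + 2
      ≡⟨ cong₂ (λ x y → + 2 * x + + 4 * y - + 18 * T + + 2) four-F₁-odd four-F₀-odd ⟩
        + 2 * (+ 3 * T + + 1 + + 2 * (+ 2 * u (suc n)))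
          + + 4 * (+ 3 * T - + 1 + + 2 * (u (suc (suc n)) - u (suc n))) - + 18 * T + + 2
      ≡⟨ cancel (u (suc (suc n))) (u (suc n)) T ⟩
        + 8 * u (suc (suc n)) ∎)
      where
      regroup : ∀ a b T → + 8 * b + + 16 * a - + 18 * T + + 2 ≡ + 2 * (+ 4 * b) + + 4 * (+ 4 * a) - + 18 * T + + 2
      regroup = solve-∀
      cancel : ∀ v x T → + 2 * (+ 3 * T + + 1 + + 2 * (+ 2 * x)) + + 4 * (+ 3 * T - + 1 + + 2 * (v - x))
                         - + 18 * T + + 2 ≡ + 8 * v
      cancel = solve-∀

  e-at-multiple-of-4 : ∀ k → (e₀ (k ℕ.* 4) ≡ + (16 ^ k)) × (e₁ (k ℕ.* 4) ≡ + 0)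
                           × (e₂ (k ℕ.* 4) ≡ + 0) × (e₃ (k ℕ.* 4) ≡ + 0)
  e-at-multiple-of-4 zero    = refl , refl , refl , refl
  e-at-multiple-of-4 (suc k) with e-at-multiple-of-4 k
  ... | e₀≡ , e₁≡ , e₂≡ , e₃≡ =
    trans (cong times16 e₀≡) (trans (sixteen (+ (16 ^ k))) (sym (ℤP.pos-* 16 (16 ^ k)))) ,
    cong times16 e₁≡ , cong times16 e₂≡ , cong times16 e₃≡
    where
    times16 : ℤ → ℤ
    times16 x = + 2 * (+ 2 * (+ 2 * (+ 2 * x)))
    sixteen : ∀ x → + 2 * (+ 2 * (+ 2 * (+ 2 * x))) ≡ + 16 * x
    sixteen = solve-∀

  F₀-blocks : ∀ {n} M → n < M ℕ.* 4 → F₀ n ≡ Σ< M (λ k → + (16 ^ k) * binomial n (k ℕ.* 4))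
  F₀-blocks {n} M n<4M = trans (binomialSum-blocks M e₀ n<4M) (Σ<-cong M block)
    where
    block : ∀ k → blockSum n e₀ k ≡ + (16 ^ k) * binomial n (k ℕ.* 4)
    block k with e-at-multiple-of-4 k
    ... | e₀≡ , e₁≡ , e₂≡ , e₃≡ rewrite e₀≡ | e₁≡ | e₂≡ | e₃≡ =
      only-first (+ (16 ^ k)) (binomial n (k ℕ.* 4)) (binomial n (1 ℕ.+ k ℕ.* 4))
                 (binomial n (2 ℕ.+ k ℕ.* 4)) (binomial n (3 ℕ.+ k ℕ.* 4))
      where
      only-first : ∀ x a b c d → a * x + b * + 0 + c * + 0 + d * + 0 ≡ x * a
      only-first = solve-∀

  F₁-blocks : ∀ {n} M → n < M ℕ.* 4 →
              + 8 * F₁ n ≡ Σ< M (λ k → + (16 ^ suc k) * binomial n (1 ℕ.+ k ℕ.* 4))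
  F₁-blocks {n} M n<4M = begin
      + 8 * F₁ n                    ≡⟨ cong (_*_ (+ 8)) (binomialSum-blocks M e₁ n<4M) ⟩
      + 8 * Σ< M (blockSum n e₁)    ≡⟨ Σ<-*ˡ M (+ 8) (blockSum n e₁) ⟨
      Σ< M (λ k → + 8 * blockSum n e₁ k)  ≡⟨ Σ<-cong M block ⟩
      Σ< M (λ k → + (16 ^ suc k) * binomial n (1 ℕ.+ k ℕ.* 4)) ∎
    where
    block : ∀ k → + 8 * blockSum n e₁ k ≡ + (16 ^ suc k) * binomial n (1 ℕ.+ k ℕ.* 4)
    block k with e-at-multiple-of-4 k
    ... | e₀≡ , e₁≡ , e₂≡ , e₃≡ rewrite e₀≡ | e₁≡ | e₂≡ | e₃≡ =
      trans (only-second (+ (16 ^ k)) (binomial n (k ℕ.* 4)) (binomial n (1 ℕ.+ k ℕ.* 4))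
                         (binomial n (2 ℕ.+ k ℕ.* 4)) (binomial n (3 ℕ.+ k ℕ.* 4)))
            (cong (_* binomial n (1 ℕ.+ k ℕ.* 4)) (sym (ℤP.pos-* 16 (16 ^ k))))
      where
      only-second : ∀ x a b c d → + 8 * (a * + 0 + b * (+ 2 * x) + c * + 0 + d * + 0) ≡ + 16 * x * b
      only-second = solve-∀

  -- Scaled so that aTerm p k / p ≡ 16^k / k and bTerm p k / p ≡ 16^k / (4k - 3) (mod p).
  aTerm bTerm : ℕ → ℕ → ℤ
  aTerm p k = (- + 4 * + (16 ^ k)) * binomial p (k ℕ.* 4)
  bTerm p k = + (16 ^ k) * binomial p (k ℕ.* 4 ℕ.∸ 3)

  module _ {p : ℕ} (m : ℕ) (p<4m+4 : p < suc m ℕ.* 4) where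

    private
      P = Σ< m (λ k → + (16 ^ suc k) * binomial p (suc k ℕ.* 4))

    F₀-head : F₀ p ≡ + 1 + P
    F₀-head = trans (F₀-blocks (suc m) p<4m+4) (Σ<-shift m _)

    Σ-aTerm : Σ< m (λ k → aTerm p (suc k)) ≡ - + 4 * P
    Σ-aTerm = trans (Σ<-cong m λ k → ℤP.*-assoc (- + 4) (+ (16 ^ suc k)) _) (Σ<-*ˡ m (- + 4) _)

  16^k≡2^[k*4] : ∀ k → 16 ^ k ≡ 2 ^ (k ℕ.* 4)
  16^k≡2^[k*4] k = trans (ℕP.^-*-assoc 2 4 k) (cong (2 ^_) (ℕP.*-comm 4 k))

  identity-1-mod-4 : ∀ m → let p = suc (m ℕ.* 4) in
    + 40 * u (m ℕ.* 4) ≡ + 4 * Σ< m (λ k → aTerm p (suc k)) + Σ< m (λ k → bTerm p (suc k))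
                         + + 16 * (+ (2 ^ (m ℕ.* 4)) - + 1) + + 6 * (+ (3 ^ (m ℕ.* 4)) - + 1)
  identity-1-mod-4 m = begin
      + 40 * u n
    ≡⟨ u[n]-via-F[1+n] n (cong (-1ℤ *_) (-1ℤ^[k*4]≡1 m)) ⟩
      + 8 * F₁ p - + 16 * F₀ p + + 6 * T - + 6
    ≡⟨ cong₂ (λ x y → x - + 16 * y + + 6 * T - + 6) (F₁-blocks (suc m) p<4m+4) (F₀-head m p<4m+4) ⟩
      B + + (16 ^ suc m) * binomial p p - + 16 * (+ 1 + P) + + 6 * T - + 6
    ≡⟨ cong₂ (λ x y → B + x * y - + 16 * (+ 1 + P) + + 6 * T - + 6)
         (trans (ℤP.pos-* 16 (16 ^ m)) (cong (λ e → + 16 * + e) (16^k≡2^[k*4] m))) (binomial-diagonal p) ⟩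
      B + + 16 * + (2 ^ n) * + 1 - + 16 * (+ 1 + P) + + 6 * T - + 6
    ≡⟨ rearrange B P (+ (2 ^ n)) T ⟩
      + 4 * (- + 4 * P) + B + + 16 * (+ (2 ^ n) - + 1) + + 6 * (T - + 1)
    ≡⟨ cong (λ a → + 4 * a + B + + 16 * (+ (2 ^ n) - + 1) + + 6 * (T - + 1)) (Σ-aTerm m p<4m+4) ⟨
      + 4 * Σ< m (λ k → aTerm p (suc k)) + B + + 16 * (+ (2 ^ n) - + 1) + + 6 * (T - + 1) ∎
    where
    n = m ℕ.* 4
    p = suc n
    T = + (3 ^ n)
    P = Σ< m (λ k → + (16 ^ suc k) * binomial p (suc k ℕ.* 4))
    B = Σ< m (λ k → bTerm p (suc k))
    p<4m+4 : p < suc m ℕ.* 4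
    p<4m+4 = ℕ.s≤s (ℕ.s≤s (ℕP.m≤n+m n 2))
    rearrange : ∀ B P S T → B + + 16 * S * + 1 - + 16 * (+ 1 + P) + + 6 * T - + 6
                            ≡ + 4 * (- + 4 * P) + B + + 16 * (S - + 1) + + 6 * (T - + 1)
    rearrange = solve-∀

  identity-3-mod-4 : ∀ m → let p = 3 ℕ.+ m ℕ.* 4 in
    + 8 * u (suc p) ≡ Σ< (suc m) (λ k → bTerm p (suc k)) - + 4 * Σ< m (λ k → aTerm p (suc k))
                      - + 18 * (+ (3 ^ (2 ℕ.+ m ℕ.* 4)) - + 1)
  identity-3-mod-4 m = begin
      + 8 * u (suc p)
    ≡⟨ u[2+n]-via-F[1+n] n (cong (λ s → -1ℤ * (-1ℤ * (-1ℤ * s))) (-1ℤ^[k*4]≡1 m)) ⟩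
      + 8 * F₁ p + + 16 * F₀ p - + 18 * T + + 2
    ≡⟨ cong₂ (λ x y → x + + 16 * y - + 18 * T + + 2)
         (F₁-blocks (suc m) (ℕP.n<1+n p)) (F₀-head m (ℕP.n<1+n p)) ⟩
      B + + 16 * (+ 1 + P) - + 18 * T + + 2
    ≡⟨ rearrange B P T ⟩
      B - + 4 * (- + 4 * P) - + 18 * (T - + 1)
    ≡⟨ cong (λ a → B - + 4 * a - + 18 * (T - + 1)) (Σ-aTerm m (ℕP.n<1+n p)) ⟨
      B - + 4 * Σ< m (λ k → aTerm p (suc k)) - + 18 * (T - + 1) ∎
    where
    n = 2 ℕ.+ m ℕ.* 4
    p = suc n
    T = + (3 ^ n)
    P = Σ< m (λ k → + (16 ^ suc k) * binomial p (suc k ℕ.* 4))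
    B = Σ< (suc m) (λ k → bTerm p (suc k))
    rearrange : ∀ B P T → B + + 16 * (+ 1 + P) - + 18 * T + + 2 ≡ B - + 4 * (- + 4 * P) - + 18 * (T - + 1)
    rearrange = solve-∀

module Fractions where

  open import Data.Nat as ℕ using (ℕ; zero; suc)
  import Data.Nat.Properties as ℕP
  open import Data.Integer as ℤ using (ℤ; +_)
  import Data.Integer.Properties as ℤP
  open import Data.Integer.Tactic.RingSolver using (solve-∀)
  open import Data.Rational using (_/_; fromℚᵘ; _+_; _*_; _-_; -_)
  import Data.Rational.Properties as ℚP
  open import Data.Rational.Unnormalised as ℚᵘ using (mkℚᵘ; *≡*)
  import Data.Rational.Unnormalised.Properties as ℚᵘP
  open import Relation.Binary.PropositionalEquality
  open ≡-Reasoning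
  open import Defs using (Σ1)
  open IntegerSums using (Σ<)

  fromℚᵘ-homo-+ : ∀ x y → fromℚᵘ (x ℚᵘ.+ y) ≡ fromℚᵘ x + fromℚᵘ y
  fromℚᵘ-homo-+ x y = ℚP.toℚᵘ-injective (ℚᵘP.≃-trans (ℚP.toℚᵘ-fromℚᵘ (x ℚᵘ.+ y))
    (ℚᵘP.≃-sym (ℚᵘP.≃-trans (ℚP.toℚᵘ-homo-+ (fromℚᵘ x) (fromℚᵘ y))
                            (ℚᵘP.+-cong (ℚP.toℚᵘ-fromℚᵘ x) (ℚP.toℚᵘ-fromℚᵘ y)))))

  fromℚᵘ-homo-* : ∀ x y → fromℚᵘ (x ℚᵘ.* y) ≡ fromℚᵘ x * fromℚᵘ y
  fromℚᵘ-homo-* x y = ℚP.toℚᵘ-injective (ℚᵘP.≃-trans (ℚP.toℚᵘ-fromℚᵘ (x ℚᵘ.* y))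
    (ℚᵘP.≃-sym (ℚᵘP.≃-trans (ℚP.toℚᵘ-homo-* (fromℚᵘ x) (fromℚᵘ y))
                            (ℚᵘP.*-cong (ℚP.toℚᵘ-fromℚᵘ x) (ℚP.toℚᵘ-fromℚᵘ y)))))

  fromℚᵘ-homo‿- : ∀ x → fromℚᵘ (ℚᵘ.- x) ≡ - fromℚᵘ x
  fromℚᵘ-homo‿- x = ℚP.toℚᵘ-injective (ℚᵘP.≃-trans (ℚP.toℚᵘ-fromℚᵘ (ℚᵘ.- x))
    (ℚᵘP.≃-sym (ℚᵘP.≃-trans (ℚP.toℚᵘ-homo‿- (fromℚᵘ x))
                            (ℚᵘP.-‿cong (ℚP.toℚᵘ-fromℚᵘ x)))))

  /-+-/ : ∀ a b d e → a / suc d + b / suc e ≡ (a ℤ.* + suc e ℤ.+ b ℤ.* + suc d) / (suc d ℕ.* suc e)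
  /-+-/ a b d e = sym (fromℚᵘ-homo-+ (mkℚᵘ a d) (mkℚᵘ b e))

  /-*-/ : ∀ a b d e → (a / suc d) * (b / suc e) ≡ (a ℤ.* b) / (suc d ℕ.* suc e)
  /-*-/ a b d e = sym (fromℚᵘ-homo-* (mkℚᵘ a d) (mkℚᵘ b e))

  -‿/ : ∀ a d → - (a / suc d) ≡ ℤ.- a / suc d
  -‿/ a d = sym (fromℚᵘ-homo‿- (mkℚᵘ a d))

  /-cross : ∀ a b d e → a ℤ.* + suc e ≡ b ℤ.* + suc d → a / suc d ≡ b / suc e
  /-cross a b d e eq = ℚP.fromℚᵘ-cong {mkℚᵘ a d} {mkℚᵘ b e} (*≡* eq)

  /-distrib-+ : ∀ a b d → (a ℤ.+ b) / suc d ≡ a / suc d + b / suc d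
  /-distrib-+ a b d = trans (ℚP.fromℚᵘ-cong {mkℚᵘ (a ℤ.+ b) d} {mkℚᵘ a d ℚᵘ.+ mkℚᵘ b d} (*≡* eq))
                            (fromℚᵘ-homo-+ (mkℚᵘ a d) (mkℚᵘ b d))
    where
    eq : (a ℤ.+ b) ℤ.* + (suc d ℕ.* suc d) ≡ (a ℤ.* + suc d ℤ.+ b ℤ.* + suc d) ℤ.* + suc d
    eq = trans (cong ((a ℤ.+ b) ℤ.*_) (ℤP.pos-* (suc d) (suc d))) (distrib a b (+ suc d))
      where
      distrib : ∀ a b D → (a ℤ.+ b) ℤ.* (D ℤ.* D) ≡ (a ℤ.* D ℤ.+ b ℤ.* D) ℤ.* D
      distrib = solve-∀

  /-distrib-- : ∀ a b d → (a ℤ.- b) / suc d ≡ a / suc d - b / suc d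
  /-distrib-- a b d = trans (/-distrib-+ a (ℤ.- b) d) (cong (_+_ (a / suc d)) (sym (-‿/ b d)))

  /-*ˡ : ∀ c a d → (c ℤ.* a) / suc d ≡ (c / 1) * (a / suc d)
  /-*ˡ c a d = trans (ℚP.fromℚᵘ-cong {mkℚᵘ (c ℤ.* a) d} {mkℚᵘ c 0 ℚᵘ.* mkℚᵘ a d} (*≡* eq))
                     (fromℚᵘ-homo-* (mkℚᵘ c 0) (mkℚᵘ a d))
    where
    eq : c ℤ.* a ℤ.* + (1 ℕ.* suc d) ≡ c ℤ.* a ℤ.* + suc d
    eq = cong (λ e → c ℤ.* a ℤ.* + e) (ℕP.*-identityˡ (suc d))

  Σ1-/ : ∀ m (g : ℕ → ℤ) d → Σ1 m (λ k → g k / suc d) ≡ Σ< m (λ k → g (suc k)) / suc d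
  Σ1-/ zero    g d = /-cross (+ 0) (+ 0) 0 d refl
  Σ1-/ (suc m) g d = trans (cong (_+ g (suc m) / suc d) (Σ1-/ m g d))
                           (sym (/-distrib-+ (Σ< m (λ k → g (suc k))) (g (suc m)) d))

module PIntegral {p : ℕ} (p-prime : Prime p) where

  open import Data.Nat as ℕ using (ℕ; zero; suc; _<_)
  import Data.Nat.Properties as ℕP
  import Data.Nat.Divisibility as ℕD
  import Data.Nat.Coprimality as Coprimality
  open import Data.Nat.Primality using (euclidsLemma; prime⇒nonTrivial)
  open import Data.Integer as ℤ using (ℤ; +_)
  import Data.Integer.Properties as ℤP
  open import Data.Integer.Divisibility.Signed as ℤD using (divides)
  import Data.Integer.Divisibility as ℤDᵤ
  open import Data.Rational using (ℚ; mkℚ; _/_; ↥_; ↧ₙ_; toℚᵘ; _+_; _*_; _-_; -_; 0ℚ)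
  import Data.Rational.Properties as ℚP
  open import Data.Rational.Unnormalised using (mkℚᵘ; *≡*)
  import Data.Rational.Unnormalised.Properties as ℚᵘP
  open import Data.Rational.Solver using (module +-*-Solver)
  open +-*-Solver using (_:+_; _:*_; _:-_; :-_; _:=_; solve)
  open import Data.Product using (_×_; _,_)
  open import Data.Sum using ([_,_]′)
  open import Data.Empty using (⊥-elim)
  open import Relation.Nullary using (¬_)
  open import Relation.Binary.PropositionalEquality
  open import Level using (0ℓ)
  open import Relation.Binary.Bundles using (Setoid)
  open import Defs using (_≡ℚ_[mod_]; Σ1)
  open Fractions

  record p∣ℚ_ (x : ℚ) : Set where
    constructor fraction
    field
      numerator     : ℤ
      denominator-1 : ℕ
      x≡            : x ≡ numerator / suc denominator-1
      p∣numerator   : + p ℤD.∣ numerator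
      p∤denominator : ¬ p ℕD.∣ suc denominator-1


  p∤* : ∀ {a b} → ¬ p ℕD.∣ a → ¬ p ℕD.∣ b → ¬ p ℕD.∣ a ℕ.* b
  p∤* {a} {b} p∤a p∤b p∣ab = [ p∤a , p∤b ]′ (euclidsLemma a b p-prime p∣ab)

  p∤1 : ¬ p ℕD.∣ 1
  p∤1 p∣1 with ℕD.∣1⇒≡1 p∣1 | prime⇒nonTrivial p-prime
  ... | refl | ()

  p∣ℚ-0 : p∣ℚ 0ℚ
  p∣ℚ-0 = fraction (+ 0) 0 refl (divides (+ 0) refl) p∤1

  p∣ℚ-+ : ∀ {x y} → p∣ℚ x → p∣ℚ y → p∣ℚ (x + y)
  p∣ℚ-+ (fraction a d refl p∣a p∤d) (fraction b e refl p∣b p∤e) =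
    fraction _ _ (/-+-/ a b d e)
      (ℤD.∣m∣n⇒∣m+n (ℤD.∣m⇒∣m*n (+ suc e) p∣a) (ℤD.∣m⇒∣m*n (+ suc d) p∣b)) (p∤* p∤d p∤e)

  p∣ℚ-neg : ∀ {x} → p∣ℚ x → p∣ℚ (- x)
  p∣ℚ-neg (fraction a d refl p∣a p∤d) = fraction (ℤ.- a) d (-‿/ a d) (ℤD.∣m⇒∣-m p∣a) p∤d

  p∣ℚ-*ˡ : ∀ c d {x} → ¬ p ℕD.∣ suc d → p∣ℚ x → p∣ℚ ((c / suc d) * x)
  p∣ℚ-*ˡ c d p∤d (fraction a e refl p∣a p∤e) =
    fraction _ _ (/-*-/ c a d e) (ℤD.∣n⇒∣m*n c p∣a) (p∤* p∤d p∤e)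

  p∣ℚ⇒normalised : ∀ {q} → p∣ℚ q → (+ p ℤDᵤ.∣ ↥ q) × ¬ p ℕD.∣ ↧ₙ q
  p∣ℚ⇒normalised {q@(mkℚ N D-1 coprime)} (fraction n d q≡ p∣n p∤d) with
    ℚᵘP.≃-trans (ℚᵘP.≃-reflexive (cong toℚᵘ q≡)) (ℚP.toℚᵘ-fromℚᵘ (mkℚᵘ n d))
  ... | *≡* cross = p∣N , p∤D
    where
    ∣N∣*d≡∣n∣*D : ℤ.∣ N ∣ ℕ.* suc d ≡ ℤ.∣ n ∣ ℕ.* suc D-1
    ∣N∣*d≡∣n∣*D = trans (sym (ℤP.abs-* N (+ suc d))) (trans (cong ℤ.∣_∣ cross) (ℤP.abs-* n (+ suc D-1)))
    D∣d : suc D-1 ℕD.∣ suc d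
    D∣d = Coprimality.coprime-divisor (Coprimality.sym (Coprimality.recompute coprime))
            (ℕD.divides ℤ.∣ n ∣ ∣N∣*d≡∣n∣*D)
    p∤D : ¬ p ℕD.∣ suc D-1
    p∤D p∣D = p∤d (ℕD.∣-trans p∣D D∣d)
    p∣N : p ℕD.∣ ℤ.∣ N ∣
    p∣N = [ (λ p∣N → p∣N) , (λ p∣d → ⊥-elim (p∤d p∣d)) ]′ (euclidsLemma ℤ.∣ N ∣ (suc d) p-prime
            (subst (p ℕD.∣_) (sym ∣N∣*d≡∣n∣*D) (ℕD.∣m⇒∣m*n (suc D-1) (ℤD.∣⇒∣ᵤ p∣n))))

  infix 4 _≈_
  data _≈_ (x y : ℚ) : Set where
    congruent : p∣ℚ (x - y) → x ≈ y

  ≈⇒≡ℚ : ∀ {x y} → x ≈ y → x ≡ℚ y [mod p ]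
  ≈⇒≡ℚ (congruent d) = p∣ℚ⇒normalised d

  ≈-refl : ∀ {x} → x ≈ x
  ≈-refl {x} = congruent (subst p∣ℚ_ (sym (ℚP.+-inverseʳ x)) p∣ℚ-0)

  ≈-reflexive : ∀ {x y} → x ≡ y → x ≈ y
  ≈-reflexive refl = ≈-refl

  ≈-sym : ∀ {x y} → x ≈ y → y ≈ x
  ≈-sym {x} {y} (congruent d) = congruent (subst p∣ℚ_ (flip x y) (p∣ℚ-neg d))
    where
    flip : ∀ x y → - (x - y) ≡ y - x
    flip = solve 2 (λ x y → :- (x :- y) := y :- x) refl

  ≈-trans : ∀ {x y z} → x ≈ y → y ≈ z → x ≈ z
  ≈-trans {x} {y} {z} (congruent d) (congruent e) =
    congruent (subst p∣ℚ_ (telescope x y z) (p∣ℚ-+ d e))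
    where
    telescope : ∀ x y z → (x - y) + (y - z) ≡ x - z
    telescope = solve 3 (λ x y z → (x :- y) :+ (y :- z) := x :- z) refl

  +-cong : ∀ {x x′ y y′} → x ≈ x′ → y ≈ y′ → x + y ≈ x′ + y′
  +-cong {x} {x′} {y} {y′} (congruent d) (congruent e) =
    congruent (subst p∣ℚ_ (interchange x x′ y y′) (p∣ℚ-+ d e))
    where
    interchange : ∀ x x′ y y′ → (x - x′) + (y - y′) ≡ (x + y) - (x′ + y′)
    interchange = solve 4 (λ x x′ y y′ → (x :- x′) :+ (y :- y′) := (x :+ y) :- (x′ :+ y′)) refl

  -‿cong : ∀ {x y} → x ≈ y → - x ≈ - y
  -‿cong {x} {y} (congruent d) = congruent (subst p∣ℚ_ (negate x y) (p∣ℚ-neg d))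
    where
    negate : ∀ x y → - (x - y) ≡ - x - - y
    negate = solve 2 (λ x y → :- (x :- y) := (:- x) :- (:- y)) refl

  *-congˡ : ∀ c d {x y} → ¬ p ℕD.∣ suc d → x ≈ y → (c / suc d) * x ≈ (c / suc d) * y
  *-congˡ c d {x} {y} p∤d (congruent e) =
    congruent (subst p∣ℚ_ (distrib (c / suc d) x y) (p∣ℚ-*ˡ c d p∤d e))
    where
    distrib : ∀ c x y → c * (x - y) ≡ c * x - c * y
    distrib = solve 3 (λ c x y → c :* (x :- y) := c :* x :- c :* y) refl

  Σ1-cong : ∀ m {f g : ℕ → ℚ} → (∀ {k} → k < m → f (suc k) ≈ g (suc k)) → Σ1 m f ≈ Σ1 m g
  Σ1-cong zero    f≈g = ≈-refl
  Σ1-cong (suc m) f≈g = +-cong (Σ1-cong m (λ k<m → f≈g (ℕP.m<n⇒m<1+n k<m))) (f≈g (ℕP.n<1+n m))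

  /-≈ : ∀ a b d → + p ℤD.∣ a ℤ.- b → ¬ p ℕD.∣ suc d → a / suc d ≈ b / suc d
  /-≈ a b d p∣a-b p∤d = congruent (fraction (a ℤ.- b) d (sym (/-distrib-- a b d)) p∣a-b p∤d)

  ≈-setoid : Setoid 0ℓ 0ℓ
  ≈-setoid = record
    { Carrier       = ℚ
    ; _≈_           = _≈_
    ; isEquivalence = record { refl = ≈-refl ; sym = ≈-sym ; trans = ≈-trans }
    }

module Summands {n : ℕ} (p-prime : Prime (suc n)) where

  open import Data.Nat as ℕ using (ℕ; suc; _<_; _≤_; _^_; _∸_)
  import Data.Nat.Properties as ℕP
  import Data.Nat.Divisibility as ℕD
  open import Data.Integer as ℤ using (+_; -_; _*_; -1ℤ)
  import Data.Integer.Properties as ℤP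
  import Data.Integer.Divisibility.Signed as ℤD
  open import Data.Integer.Tactic.RingSolver using (solve-∀)
  open import Data.Rational using (_/_)
  open import Relation.Nullary using (¬_)
  open import Relation.Binary.PropositionalEquality
  open ≡-Reasoning
  open import Defs using (_÷ℕ_; Σ1)
  open IntegerSums
  open Binomial
  open QuarterSums using (aTerm; bTerm)
  open Fractions
  open PIntegral p-prime

  scaled-binomial/p≈ : ∀ c {j} → j < n → (c * binomial (suc n) (suc j)) / suc n ≈ (c * -1ℤ ℤ.^ j) / suc j
  scaled-binomial/p≈ c {j} j<n =
    ≈-trans (≈-reflexive (/-cross (c * binomial (suc n) (suc j)) (c * binomial n j) n j absorbed))
            (/-≈ (c * binomial n j) (c * -1ℤ ℤ.^ j) j p∣difference p∤1+j)
    where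
    absorbed : c * binomial (suc n) (suc j) * + suc j ≡ c * binomial n j * + suc n
    absorbed = begin
        c * binomial (suc n) (suc j) * + suc j    ≡⟨ reorder c (binomial (suc n) (suc j)) (+ suc j) ⟩
        c * (+ suc j * binomial (suc n) (suc j))  ≡⟨ cong (c *_) (binomial-absorption n j) ⟩
        c * (+ suc n * binomial n j)              ≡⟨ reorder c (binomial n j) (+ suc n) ⟨
        c * binomial n j * + suc n                ∎
      where
      reorder : ∀ c b k → c * b * k ≡ c * (k * b)
      reorder = solve-∀
    p∣difference : + suc n ℤD.∣ c * binomial n j ℤ.- c * -1ℤ ℤ.^ j
    p∣difference = subst (+ suc n ℤD.∣_) (distrib c (binomial n j) (-1ℤ ℤ.^ j))
      (ℤD.∣n⇒∣m*n c (binomial[p-1]≡sign p-prime (ℕP.<⇒≤ j<n)))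
      where
      distrib : ∀ c b s → c * (b ℤ.- s) ≡ c * b ℤ.- c * s
      distrib = solve-∀
    p∤1+j : ¬ suc n ℕD.∣ suc j
    p∤1+j = ℕD.>⇒∤ (ℕ.s≤s j<n)

  aTerm/p≈ : ∀ k → suc k ℕ.* 4 ≤ n → aTerm (suc n) (suc k) / suc n ≈ (+ (16 ^ suc k)) ÷ℕ suc k
  aTerm/p≈ k 4k+4≤n = ≈-trans (scaled-binomial/p≈ c 4k+4≤n)
    (≈-reflexive (/-cross (c * -1ℤ ℤ.^ (3 ℕ.+ k ℕ.* 4)) x (3 ℕ.+ k ℕ.* 4) k cancel))
    where
    x = + (16 ^ suc k)
    c = - + 4 * x
    cancel : c * -1ℤ ℤ.^ (3 ℕ.+ k ℕ.* 4) * + suc k ≡ x * + (suc k ℕ.* 4)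
    cancel = begin
        c * -1ℤ ℤ.^ (3 ℕ.+ k ℕ.* 4) * + suc k
      ≡⟨ cong (λ s → c * (-1ℤ * (-1ℤ * (-1ℤ * s))) * + suc k) (-1ℤ^[k*4]≡1 k) ⟩
        - + 4 * x * -1ℤ * + suc k
      ≡⟨ signs x (+ suc k) ⟩
        x * (+ suc k * + 4)
      ≡⟨ cong (x *_) (ℤP.pos-* (suc k) 4) ⟨
        x * + (suc k ℕ.* 4) ∎
      where
      signs : ∀ x K → - + 4 * x * -1ℤ * K ≡ x * (K * + 4)
      signs = solve-∀

  bTerm/p≈ : ∀ k → k ℕ.* 4 < n → bTerm (suc n) (suc k) / suc n ≈ (+ (16 ^ suc k)) ÷ℕ (4 ℕ.* suc k ∸ 3)
  bTerm/p≈ k 4k<n = ≈-trans (scaled-binomial/p≈ x 4k<n) (≈-reflexive (begin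
      x * -1ℤ ℤ.^ (k ℕ.* 4) / suc (k ℕ.* 4)   ≡⟨ cong (λ s → x * s / suc (k ℕ.* 4)) (-1ℤ^[k*4]≡1 k) ⟩
      x * + 1 / suc (k ℕ.* 4)                 ≡⟨ cong (_/ suc (k ℕ.* 4)) (ℤP.*-identityʳ x) ⟩
      x / suc (k ℕ.* 4)                       ≡⟨ cong (λ t → x / suc (t ∸ 3 ∸ 1)) (ℕP.*-comm (suc k) 4) ⟩
      x ÷ℕ (4 ℕ.* suc k ∸ 3)                 ∎))
    where
    x = + (16 ^ suc k)

  aSum/p≈ : ∀ m → m ℕ.* 4 ≤ n →
            Σ< m (λ k → aTerm (suc n) (suc k)) / suc n ≈ Σ1 m (λ k → (+ (16 ^ k)) ÷ℕ k)
  aSum/p≈ m 4m≤n = ≈-trans (≈-reflexive (sym (Σ1-/ m (aTerm (suc n)) n)))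
    (Σ1-cong m λ {k} k<m → aTerm/p≈ k (ℕP.≤-trans (ℕP.*-monoˡ-≤ 4 k<m) 4m≤n))

  bSum/p≈ : ∀ m → m ℕ.* 4 ≤ 3 ℕ.+ n →
            Σ< m (λ k → bTerm (suc n) (suc k)) / suc n ≈ Σ1 m (λ k → (+ (16 ^ k)) ÷ℕ (4 ℕ.* k ∸ 3))
  bSum/p≈ m 4m≤3+n = ≈-trans (≈-reflexive (sym (Σ1-/ m (bTerm (suc n)) n)))
    (Σ1-cong m λ {k} k<m → bTerm/p≈ k (ℕP.+-cancelˡ-≤ 3 _ _ (ℕP.≤-trans (ℕP.*-monoˡ-≤ 4 k<m) 4m≤3+n)))

module RationalIdentities where

  open import Data.Integer as ℤ using (+_)
  open import Data.Rational using (_/_; _+_; _*_; _-_)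
  import Data.Rational.Properties as ℚP
  open import Data.Rational.Solver using (module +-*-Solver)
  open +-*-Solver using (_:+_; _:*_; _:-_; _:=_; solve)
  open import Relation.Binary.PropositionalEquality
  open ≡-Reasoning
  open import Defs using (fr)
  open Fractions

  -- The first and last steps hold because closed rationals evaluate: fr 1 40 * (40 / 1) to 1ℚ,
  -- fr 1 40 * (4 / 1) to fr 1 10, and so on.
  /-identity-1-mod-4 : ∀ U a b x y d → + 40 ℤ.* U ≡ + 4 ℤ.* a ℤ.+ b ℤ.+ + 16 ℤ.* x ℤ.+ + 6 ℤ.* y →
    U / suc d ≡ fr (+ 1) 10 * (a / suc d) + fr (+ 1) 40 * (b / suc d)
                + fr (+ 2) 5 * (x / suc d) + fr (+ 3) 20 * (y / suc d)
  /-identity-1-mod-4 U a b x y d h = begin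
      U / suc d
    ≡⟨ ℚP.*-identityˡ (U / suc d) ⟨
      (f * (+ 40 / 1)) * (U / suc d)
    ≡⟨ ℚP.*-assoc f (+ 40 / 1) (U / suc d) ⟩
      f * ((+ 40 / 1) * (U / suc d))
    ≡⟨ cong (f *_) (/-*ˡ (+ 40) U d) ⟨
      f * ((+ 40 ℤ.* U) / suc d)
    ≡⟨ cong (λ t → f * (t / suc d)) h ⟩
      f * ((+ 4 ℤ.* a ℤ.+ b ℤ.+ + 16 ℤ.* x ℤ.+ + 6 ℤ.* y) / suc d)
    ≡⟨ cong (f *_) split ⟩
      f * ((+ 4 / 1) * A + B + (+ 16 / 1) * X + (+ 6 / 1) * Y)
    ≡⟨ distribute f (+ 4 / 1) (+ 16 / 1) (+ 6 / 1) A B X Y ⟩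
      (f * (+ 4 / 1)) * A + f * B + (f * (+ 16 / 1)) * X + (f * (+ 6 / 1)) * Y ∎
    where
    f = fr (+ 1) 40
    A = a / suc d
    B = b / suc d
    X = x / suc d
    Y = y / suc d
    split : (+ 4 ℤ.* a ℤ.+ b ℤ.+ + 16 ℤ.* x ℤ.+ + 6 ℤ.* y) / suc d
            ≡ (+ 4 / 1) * A + B + (+ 16 / 1) * X + (+ 6 / 1) * Y
    split = trans (/-distrib-+ (+ 4 ℤ.* a ℤ.+ b ℤ.+ + 16 ℤ.* x) (+ 6 ℤ.* y) d)
      (cong₂ _+_ (trans (/-distrib-+ (+ 4 ℤ.* a ℤ.+ b) (+ 16 ℤ.* x) d)
                   (cong₂ _+_ (trans (/-distrib-+ (+ 4 ℤ.* a) b d) (cong (_+ B) (/-*ˡ (+ 4) a d)))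
                              (/-*ˡ (+ 16) x d)))
                 (/-*ˡ (+ 6) y d))
    distribute : ∀ f c₁ c₂ c₃ A B X Y →
      f * (c₁ * A + B + c₂ * X + c₃ * Y) ≡ (f * c₁) * A + f * B + (f * c₂) * X + (f * c₃) * Y
    distribute = solve 8 (λ f c₁ c₂ c₃ A B X Y →
      f :* (c₁ :* A :+ B :+ c₂ :* X :+ c₃ :* Y)
        := (f :* c₁) :* A :+ f :* B :+ (f :* c₂) :* X :+ (f :* c₃) :* Y) refl

  /-identity-3-mod-4 : ∀ V b a y d → + 8 ℤ.* V ≡ b ℤ.- + 4 ℤ.* a ℤ.- + 18 ℤ.* y →
    V / suc d ≡ fr (+ 1) 8 * (b / suc d) - fr (+ 1) 2 * (a / suc d) - fr (+ 9) 4 * (y / suc d)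
  /-identity-3-mod-4 V b a y d h = begin
      V / suc d
    ≡⟨ ℚP.*-identityˡ (V / suc d) ⟨
      (f * (+ 8 / 1)) * (V / suc d)
    ≡⟨ ℚP.*-assoc f (+ 8 / 1) (V / suc d) ⟩
      f * ((+ 8 / 1) * (V / suc d))
    ≡⟨ cong (f *_) (/-*ˡ (+ 8) V d) ⟨
      f * ((+ 8 ℤ.* V) / suc d)
    ≡⟨ cong (λ t → f * (t / suc d)) h ⟩
      f * ((b ℤ.- + 4 ℤ.* a ℤ.- + 18 ℤ.* y) / suc d)
    ≡⟨ cong (f *_) split ⟩
      f * (B - (+ 4 / 1) * A - (+ 18 / 1) * Y)
    ≡⟨ distribute f (+ 4 / 1) (+ 18 / 1) A B Y ⟩
      f * B - (f * (+ 4 / 1)) * A - (f * (+ 18 / 1)) * Y ∎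
    where
    f = fr (+ 1) 8
    A = a / suc d
    B = b / suc d
    Y = y / suc d
    split : (b ℤ.- + 4 ℤ.* a ℤ.- + 18 ℤ.* y) / suc d ≡ B - (+ 4 / 1) * A - (+ 18 / 1) * Y
    split = trans (/-distrib-- (b ℤ.- + 4 ℤ.* a) (+ 18 ℤ.* y) d)
      (cong₂ _-_ (trans (/-distrib-- b (+ 4 ℤ.* a) d) (cong (B -_) (/-*ˡ (+ 4) a d)))
                 (/-*ˡ (+ 18) y d))
    distribute : ∀ f c₁ c₂ A B Y → f * (B - c₁ * A - c₂ * Y) ≡ f * B - (f * c₁) * A - (f * c₂) * Y
    distribute = solve 6 (λ f c₁ c₂ A B Y →
      f :* (B :- c₁ :* A :- c₂ :* Y) := f :* B :- (f :* c₁) :* A :- (f :* c₂) :* Y) refl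

module ResidueCases where

  open import Data.Nat as ℕ using (ℕ; suc; _<_; _*_; _∸_; _^_)
  import Data.Nat.Properties as ℕP
  import Data.Nat.Divisibility as ℕD
  open import Data.Integer using (+_)
  import Data.Rational as ℚ
  open import Relation.Binary.PropositionalEquality using (_≡_; refl; cong)
  open import Relation.Nullary using (¬_)
  open import Defs
  open IntegerSums using (Σ<)
  open QuarterSums using (aTerm; bTerm; identity-1-mod-4; identity-3-mod-4)
  open RationalIdentities

  Congruence-1-mod-4 : ℕ → ℕ → Set
  Congruence-1-mod-4 p M =
    (u (p ∸ 1) ÷ℕ p)
      ≡ℚ (fr (+ 1) 10 ℚ.* Σ1 M (λ k → (+ (16 ^ k)) ÷ℕ k)
          ℚ.+ fr (+ 1) 40 ℚ.* Σ1 M (λ k → (+ (16 ^ k)) ÷ℕ (4 * k ∸ 3))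
          ℚ.+ fr (+ 2) 5 ℚ.* qp p 2
          ℚ.+ fr (+ 3) 20 ℚ.* qp p 3) [mod p ]

  Congruence-3-mod-4 : ℕ → ℕ → ℕ → Set
  Congruence-3-mod-4 p M M′ =
    (u (p ℕ.+ 1) ÷ℕ p)
      ≡ℚ (fr (+ 1) 8 ℚ.* Σ1 M (λ k → (+ (16 ^ k)) ÷ℕ (4 * k ∸ 3))
          ℚ.- fr (+ 1) 2 ℚ.* Σ1 M′ (λ k → (+ (16 ^ k)) ÷ℕ k)
          ℚ.- fr (+ 9) 4 ℚ.* qp p 3) [mod p ]

  module _ {p : ℕ} (p-prime : Prime p) (5<p : 5 < p) where

    open PIntegral p-prime
    open import Relation.Binary.Reasoning.Setoid ≈-setoid

    private
      p∤2 : ¬ p ℕD.∣ 2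
      p∤2 = ℕD.>⇒∤ (ℕP.<-trans (ℕ.s≤s (ℕ.s≤s (ℕ.s≤s ℕ.z≤n))) 5<p)

      p∤5 : ¬ p ℕD.∣ 5
      p∤5 = ℕD.>⇒∤ 5<p

    congruence-1-mod-4 : ∀ m → p ≡ suc (m * 4) → Congruence-1-mod-4 p m
    congruence-1-mod-4 m refl = ≈⇒≡ℚ (begin
        u n ÷ℕ p
      ≡⟨ /-identity-1-mod-4 (u n) A B _ _ n (identity-1-mod-4 m) ⟩
        fr (+ 1) 10 ℚ.* (A ℚ./ p) ℚ.+ fr (+ 1) 40 ℚ.* (B ℚ./ p)
          ℚ.+ fr (+ 2) 5 ℚ.* qp p 2 ℚ.+ fr (+ 3) 20 ℚ.* qp p 3
      ≈⟨ +-cong (+-cong (+-cong (*-congˡ (+ 1) 9 p∤10 (aSum/p≈ m ℕP.≤-refl))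
                                (*-congˡ (+ 1) 39 p∤40 (bSum/p≈ m (ℕP.m≤n+m n 3))))
                        ≈-refl) ≈-refl ⟩
        fr (+ 1) 10 ℚ.* Σ1 m (λ k → (+ (16 ^ k)) ÷ℕ k)
          ℚ.+ fr (+ 1) 40 ℚ.* Σ1 m (λ k → (+ (16 ^ k)) ÷ℕ (4 * k ∸ 3))
          ℚ.+ fr (+ 2) 5 ℚ.* qp p 2 ℚ.+ fr (+ 3) 20 ℚ.* qp p 3 ∎)
      where
      n = m * 4
      open Summands {n} p-prime
      A = Σ< m (λ k → aTerm p (suc k))
      B = Σ< m (λ k → bTerm p (suc k))
      p∤10 : ¬ p ℕD.∣ 10
      p∤10 = p∤* p∤2 p∤5
      p∤40 : ¬ p ℕD.∣ 40
      p∤40 = p∤* p∤2 (p∤* p∤2 p∤10)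

    congruence-3-mod-4 : ∀ m → p ≡ 3 ℕ.+ m * 4 → Congruence-3-mod-4 p (suc m) m
    congruence-3-mod-4 m refl = ≈⇒≡ℚ (begin
        u (p ℕ.+ 1) ÷ℕ p
      ≡⟨ cong (λ t → u t ÷ℕ p) (ℕP.+-comm p 1) ⟩
        u (suc p) ÷ℕ p
      ≡⟨ /-identity-3-mod-4 (u (suc p)) B A _ n (identity-3-mod-4 m) ⟩
        fr (+ 1) 8 ℚ.* (B ℚ./ p) ℚ.- fr (+ 1) 2 ℚ.* (A ℚ./ p) ℚ.- fr (+ 9) 4 ℚ.* qp p 3
      ≈⟨ +-cong (+-cong (*-congˡ (+ 1) 7 p∤8 (bSum/p≈ (suc m) (ℕP.m≤n+m (suc m * 4) 1)))
                        (-‿cong (*-congˡ (+ 1) 1 p∤2 (aSum/p≈ m (ℕP.m≤n+m (m * 4) 2)))))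
                ≈-refl ⟩
        fr (+ 1) 8 ℚ.* Σ1 (suc m) (λ k → (+ (16 ^ k)) ÷ℕ (4 * k ∸ 3))
          ℚ.- fr (+ 1) 2 ℚ.* Σ1 m (λ k → (+ (16 ^ k)) ÷ℕ k)
          ℚ.- fr (+ 9) 4 ℚ.* qp p 3 ∎)
      where
      n = 2 ℕ.+ m * 4
      open Summands {n} p-prime
      A = Σ< m (λ k → aTerm p (suc k))
      B = Σ< (suc m) (λ k → bTerm p (suc k))
      p∤8 : ¬ p ℕD.∣ 8
      p∤8 = p∤* p∤2 (p∤* p∤2 p∤2)

open import Defs
open import Data.Nat using (ℕ; _∸_; _+_; _*_; _<_; _/_; _^_; _%_)
open import Data.Nat.Primality using (Prime)
open import Data.Integer using (+_)
open import Data.Rational as ℚ using ()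
open import Data.Product using (_×_; _,_)
open import Relation.Binary.PropositionalEquality using (_≡_; sym; trans; cong; subst; subst₂)
open import Data.Nat.DivMod using (m≡m%n+[m/n]*n; m*n/n≡m)
open import Data.Nat.Properties using (+-comm)
open ResidueCases

corollary5p3 : (p : ℕ) → Prime p → 5 < p →
    (p % 4 ≡ 1 →
      (u (p ∸ 1) ÷ℕ p)
        ≡ℚ (fr (+ 1) 10 ℚ.* Σ1 ((p ∸ 1) / 4) (λ k → (+ (16 ^ k)) ÷ℕ k)
            ℚ.+ fr (+ 1) 40 ℚ.* Σ1 ((p ∸ 1) / 4) (λ k → (+ (16 ^ k)) ÷ℕ (4 * k ∸ 3))
            ℚ.+ fr (+ 2) 5 ℚ.* qp p 2
            ℚ.+ fr (+ 3) 20 ℚ.* qp p 3) [mod p ])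
    × (p % 4 ≡ 3 →
      (u (p + 1) ÷ℕ p)
        ≡ℚ (fr (+ 1) 8 ℚ.* Σ1 ((p + 1) / 4) (λ k → (+ (16 ^ k)) ÷ℕ (4 * k ∸ 3))
            ℚ.- fr (+ 1) 2 ℚ.* Σ1 ((p ∸ 3) / 4) (λ k → (+ (16 ^ k)) ÷ℕ k)
            ℚ.- fr (+ 9) 4 ℚ.* qp p 3) [mod p ])
corollary5p3 p p-prime 5<p = case-1 , case-3
  where
  q = p / 4

  case-1 : p % 4 ≡ 1 → Congruence-1-mod-4 p ((p ∸ 1) / 4)
  case-1 p%4≡1 = subst (Congruence-1-mod-4 p) (sym bound) (congruence-1-mod-4 p-prime 5<p q p≡4q+1)
    where
    p≡4q+1 : p ≡ 1 + q * 4
    p≡4q+1 = trans (m≡m%n+[m/n]*n p 4) (cong (_+ q * 4) p%4≡1)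
    bound : (p ∸ 1) / 4 ≡ q
    bound = trans (cong (λ t → (t ∸ 1) / 4) p≡4q+1) (m*n/n≡m q 4)

  case-3 : p % 4 ≡ 3 → Congruence-3-mod-4 p ((p + 1) / 4) ((p ∸ 3) / 4)
  case-3 p%4≡3 = subst₂ (Congruence-3-mod-4 p) (sym bound⁺) (sym bound⁻)
                        (congruence-3-mod-4 p-prime 5<p q p≡4q+3)
    where
    p≡4q+3 : p ≡ 3 + q * 4
    p≡4q+3 = trans (m≡m%n+[m/n]*n p 4) (cong (_+ q * 4) p%4≡3)
    bound⁺ : (p + 1) / 4 ≡ 1 + q
    bound⁺ = trans (cong (_/ 4) (trans (+-comm p 1) (cong (_+_ 1) p≡4q+3))) (m*n/n≡m (1 + q) 4)
    bound⁻ : (p ∸ 3) / 4 ≡ q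
    bound⁻ = trans (cong (λ t → (t ∸ 3) / 4) p≡4q+3) (m*n/n≡m q 4)
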